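{- Let $p$ be a prime number with $p \equiv 1$ or $p\equiv 4 \pmod 5$. Let $b > c > 0$ be the (unique) pair of positive integers with $p = b^2 + 3bc + c^2$. Let $v$ be an integer with $0 < v < p$ and $v^2 + v - 1 \equiv 0 \pmod{p}$, and perform the Euclidean algorithm with $p$ and $v$, producing remainders $r_1, r_2, \ldots$ (with $r_{ -1} = p$, $r_0 = v$). Then the first remainder less than $\sqrt{p/5}$ is equal to $c$, and the remainder immediately preceding it is equal to either $b$ or $b + c$.
   Context: The Euclidean algorithm with positive integers $u > v$: set $r_{ -1} = u$, $r_0 = v$, and for $i \ge 1$ write $r_{i-2} = q_i r_{i-1} + r_i$ with $0 \le r_i < r_{i-1}$ (division with remainder), stopping at the first index $s$ with $r_s = 0$. The $q_i$ are the quotients and the $r_i$ the remainders. -}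

module Defs where

open import Data.Nat using (ℕ; zero; suc)
open import Data.Nat.DivMod using (_%_)
open import Data.Product using (_×_; _,_; proj₁; proj₂)

-- Once the algorithm has stopped (second entry 0) we just return (0 , 0);
-- these values are never relevant.
euclidStep : ℕ × ℕ → ℕ × ℕ
euclidStep (a , zero)  = (zero , zero)
euclidStep (a , suc b) = (suc b , a % suc b)

-- euclidPair u v i = (r_{i-1} , r_i), with r_{-1} = u, r_0 = v.
euclidPair : ℕ → ℕ → ℕ → ℕ × ℕ
euclidPair u v zero    = (u , v)
euclidPair u v (suc i) = euclidStep (euclidPair u v i)

rem : ℕ → ℕ → ℕ → ℕ
rem u v i = proj₂ (euclidPair u v i)

prevRem : ℕ → ℕ → ℕ → ℕ
prevRem u v i = proj₁ (euclidPair u v i)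

-- Put N = b² + 3bc + c² = p. Running the Euclidean algorithm backwards from (b , c) along the
-- continued fraction of (b + 2c) / (b + c), and from (b + c , c) along that of (b + c) / b, gives
-- pairs (N , v₁) and (N , v₂) whose Euclidean algorithms pass through (b , c) and (b + c , c),
-- all earlier remainders being at least b.  The continued-fraction matrices have determinant ±1,
-- which yields c v₁ ≡ b + c and c v₂ ≡ -(b + 2c) (mod p); since
-- (c X - (b + c)) (c X + (b + 2c)) = c² (X² + X - 1) - N, the numbers v₁ and v₂ are the two roots
-- of X² + X - 1 in [0 , p), so v is one of them.  Finally 5c² < p ≤ 5b², so c is the first
-- remainder below √(p/5).
module Submission where

open import Defs
open import Data.List using ([]; _∷_)
open import Data.Product using (_×_; _,_; proj₁; proj₂; ∃-syntax; ∃₂)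
open import Data.Sum using (_⊎_; inj₁; inj₂; [_,_]′)
open import Relation.Nullary using (¬_; contradiction)
open import Relation.Binary.PropositionalEquality

module QuadraticCongruence where

  open import Data.Nat.Base as ℕ using (ℕ; zero; suc)
  import Data.Nat.Properties as ℕ
  import Data.Nat.Divisibility as ℕ
  open import Data.Nat.Primality using (Prime; euclidsLemma)
  open import Data.Integer.Base using (ℤ; +_; -_; _+_; _-_; _*_; 1ℤ; ∣_∣)
  open import Data.Integer.Properties using (abs-*; +-injective; ∣i∣≡0⇒i≡0; i-j≡0⇒i≡j; ∣m⊝n∣≤m⊔n; m-n≡m⊖n; pos-+; pos-*)
  open import Data.Integer.Divisibility.Signed using (_∣_; divides; ∣ᵤ⇒∣; ∣⇒∣ᵤ; ∣-reflexive; ∣m∣n⇒∣m-n; ∣n⇒∣m*n)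
  open import Data.Integer.Tactic.RingSolver using (solve-∀; solve)
  import Data.Sum as Sum

  private variable
    p c v w : ℕ
    i j k : ℤ

  prime∣*⇒∣⊎∣ : Prime p → + p ∣ i * j → (+ p ∣ i) ⊎ (+ p ∣ j)
  prime∣*⇒∣⊎∣ {p} {i} {j} p-prime p∣ij =
    Sum.map ∣ᵤ⇒∣ ∣ᵤ⇒∣ (euclidsLemma ∣ i ∣ ∣ j ∣ p-prime (subst (p ℕ.∣_) (abs-* i j) (∣⇒∣ᵤ p∣ij)))

  ∣-difference⇒≡ : v ℕ.< p → w ℕ.< p → + p ∣ + v - + w → v ≡ w
  ∣-difference⇒≡ {v} {p} {w} v<p w<p p∣v-w =
    +-injective (i-j≡0⇒i≡j (+ v) (+ w) (∣i∣≡0⇒i≡0 (small-multiple⇒0 ∣v-w∣<p (∣⇒∣ᵤ p∣v-w))))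
    where
    ∣v-w∣<p : ∣ + v - + w ∣ ℕ.< p
    ∣v-w∣<p = subst (ℕ._< p) (cong ∣_∣ (sym (m-n≡m⊖n v w))) (ℕ.≤-<-trans (∣m⊝n∣≤m⊔n v w) (ℕ.⊔-lub v<p w<p))
    small-multiple⇒0 : ∀ {n} → n ℕ.< p → p ℕ.∣ n → n ≡ 0
    small-multiple⇒0 {zero}  _   _   = refl
    small-multiple⇒0 {suc n} n<p p∣n = contradiction p∣n (ℕ.>⇒∤ n<p)

  congruence-unique : Prime p → ¬ p ℕ.∣ c → v ℕ.< p → w ℕ.< p →
    + p ∣ + c * + v - k → + p ∣ + c * + w - k → v ≡ w
  congruence-unique {p} {c} {v} {w} {k} p-prime p∤c v<p w<p p∣cv-k p∣cw-k
    with prime∣*⇒∣⊎∣ {i = + c} p-prime (subst (+ p ∣_) (difference (+ c) (+ v) (+ w) k) (∣m∣n⇒∣m-n p∣cv-k p∣cw-k))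
    where
    difference : ∀ C V W K → (C * V - K) - (C * W - K) ≡ C * (V - W)
    difference = solve-∀
  ... | inj₁ p∣c   = contradiction (∣⇒∣ᵤ p∣c) p∤c
  ... | inj₂ p∣v-w = ∣-difference⇒≡ v<p w<p p∣v-w

  module _ {P : ℤ} (B C : ℤ) (P≡ : P ≡ B * B + + 3 * B * C + C * C) where

    quadratic-factors : ∀ {V} → P ∣ V * V + V - 1ℤ → P ∣ (C * V - (B + C)) * (C * V - - (B + C + C))
    quadratic-factors {V} P∣ = subst (P ∣_) (sym factorisation) (∣m∣n⇒∣m-n (∣n⇒∣m*n (C * C) P∣) (∣-reflexive P≡))
      where
      factorisation : (C * V - (B + C)) * (C * V - - (B + C + C)) ≡ C * C * (V * V + V - 1ℤ) - (B * B + + 3 * B * C + C * C)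
      factorisation = solve (B ∷ C ∷ V ∷ [])

    root₊ : ∀ {Γ Δ} → (B + C + C) * Δ ≡ (B + C) * Γ + 1ℤ → P ∣ C * (B * Γ + C * Δ) - (B + C)
    root₊ {Γ} {Δ} det = divides (Γ - Δ) (begin
      C * (B * Γ + C * Δ) - (B + C)
        ≡⟨ solve (B ∷ C ∷ Γ ∷ Δ ∷ []) ⟩
      C * (B * Γ + C * Δ) + (B + C) * (B + C) * Γ - (B + C) * ((B + C) * Γ + 1ℤ)
        ≡⟨ cong (λ t → C * (B * Γ + C * Δ) + (B + C) * (B + C) * Γ - (B + C) * t) det ⟨
      C * (B * Γ + C * Δ) + (B + C) * (B + C) * Γ - (B + C) * ((B + C + C) * Δ)
        ≡⟨ solve (B ∷ C ∷ Γ ∷ Δ ∷ []) ⟩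
      (Γ - Δ) * (B * B + + 3 * B * C + C * C)
        ≡⟨ cong ((Γ - Δ) *_) P≡ ⟨
      (Γ - Δ) * P ∎)
      where open ≡-Reasoning

    root₋ : ∀ {Γ Δ} → B * Γ ≡ (B + C) * Δ + 1ℤ → P ∣ C * ((B + C) * Γ + C * Δ) - - (B + C + C)
    root₋ {Γ} {Δ} det = divides (Γ - Δ) (begin
      C * ((B + C) * Γ + C * Δ) - - (B + C + C)
        ≡⟨ solve (B ∷ C ∷ Γ ∷ Δ ∷ []) ⟩
      C * ((B + C) * Γ + C * Δ) + (B + C + C) * ((B + C) * Δ + 1ℤ) - (B + C + C) * ((B + C) * Δ)
        ≡⟨ cong (λ t → C * ((B + C) * Γ + C * Δ) + (B + C + C) * t - (B + C + C) * ((B + C) * Δ)) det ⟨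
      C * ((B + C) * Γ + C * Δ) + (B + C + C) * (B * Γ) - (B + C + C) * ((B + C) * Δ)
        ≡⟨ solve (B ∷ C ∷ Γ ∷ Δ ∷ []) ⟩
      (Γ - Δ) * (B * B + + 3 * B * C + C * C)
        ≡⟨ cong ((Γ - Δ) *_) P≡ ⟨
      (Γ - Δ) * P ∎)
      where open ≡-Reasoning

  pos-det : ∀ x y γ δ → x ℕ.* δ ≡ y ℕ.* γ ℕ.+ 1 → + x * + δ ≡ + y * + γ + 1ℤ
  pos-det x y γ δ eq = begin
    + x * + δ            ≡⟨ pos-* x δ ⟨
    + (x ℕ.* δ)          ≡⟨ cong +_ eq ⟩
    + (y ℕ.* γ ℕ.+ 1)    ≡⟨ pos-+ (y ℕ.* γ) 1 ⟩
    + (y ℕ.* γ) + 1ℤ     ≡⟨ cong (_+ 1ℤ) (pos-* y γ) ⟩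
    + y * + γ + 1ℤ       ∎
    where open ≡-Reasoning

  pos-lin : ∀ x y γ δ → + (x ℕ.* γ ℕ.+ y ℕ.* δ) ≡ + x * + γ + + y * + δ
  pos-lin x y γ δ = trans (pos-+ (x ℕ.* γ) (y ℕ.* δ)) (cong₂ _+_ (pos-* x γ) (pos-* y δ))

  pos-quadratic : ∀ b c → + (b ℕ.* b ℕ.+ 3 ℕ.* b ℕ.* c ℕ.+ c ℕ.* c) ≡ + b * + b + + 3 * + b * + c + + c * + c
  pos-quadratic b c = begin
    + (b ℕ.* b ℕ.+ 3 ℕ.* b ℕ.* c ℕ.+ c ℕ.* c)         ≡⟨ pos-+ (b ℕ.* b ℕ.+ 3 ℕ.* b ℕ.* c) (c ℕ.* c) ⟩
    + (b ℕ.* b ℕ.+ 3 ℕ.* b ℕ.* c) + + (c ℕ.* c)       ≡⟨ cong (_+ + (c ℕ.* c)) (pos-+ (b ℕ.* b) (3 ℕ.* b ℕ.* c)) ⟩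
    + (b ℕ.* b) + + (3 ℕ.* b ℕ.* c) + + (c ℕ.* c)     ≡⟨ cong₂ (λ X Y → X + Y + + (c ℕ.* c)) (pos-* b b) (pos-* (3 ℕ.* b) c) ⟩
    + b * + b + + (3 ℕ.* b) * + c + + (c ℕ.* c)       ≡⟨ cong₂ (λ X Y → + b * + b + X * + c + Y) (pos-* 3 b) (pos-* c c) ⟩
    + b * + b + + 3 * + b * + c + + c * + c           ∎
    where open ≡-Reasoning

  pos-x²+x-1 : 0 ℕ.< v → + (v ℕ.* v ℕ.+ v ℕ.∸ 1) ≡ + v * + v + + v - 1ℤ
  pos-x²+x-1 {v} 0<v = begin
    + (v ℕ.* v ℕ.+ v ℕ.∸ 1)                  ≡⟨ +1-1 _ ⟩
    + (v ℕ.* v ℕ.+ v ℕ.∸ 1) + 1ℤ - 1ℤ        ≡⟨ cong (_- 1ℤ) (pos-+ (v ℕ.* v ℕ.+ v ℕ.∸ 1) 1) ⟨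
    + (v ℕ.* v ℕ.+ v ℕ.∸ 1 ℕ.+ 1) - 1ℤ       ≡⟨ cong (λ n → + n - 1ℤ) (ℕ.m∸n+n≡m (ℕ.≤-trans 0<v (ℕ.m≤n+m v (v ℕ.* v)))) ⟩
    + (v ℕ.* v ℕ.+ v) - 1ℤ                   ≡⟨ cong (_- 1ℤ) (trans (pos-+ (v ℕ.* v) v) (cong (_+ + v) (pos-* v v))) ⟩
    + v * + v + + v - 1ℤ                     ∎
    where
    open ≡-Reasoning
    +1-1 : ∀ i → i ≡ i + 1ℤ - 1ℤ
    +1-1 = solve-∀

  roots-of-x²+x-1 : ∀ {p} b c {γ₁ δ₁ γ₂ δ₂ v} → Prime p → p ≡ b ℕ.* b ℕ.+ 3 ℕ.* b ℕ.* c ℕ.+ c ℕ.* c → ¬ p ℕ.∣ c →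
    (b ℕ.+ c ℕ.+ c) ℕ.* δ₁ ≡ (b ℕ.+ c) ℕ.* γ₁ ℕ.+ 1 → b ℕ.* γ₂ ≡ (b ℕ.+ c) ℕ.* δ₂ ℕ.+ 1 →
    b ℕ.* γ₁ ℕ.+ c ℕ.* δ₁ ℕ.< p → (b ℕ.+ c) ℕ.* γ₂ ℕ.+ c ℕ.* δ₂ ℕ.< p →
    0 ℕ.< v → v ℕ.< p → p ℕ.∣ v ℕ.* v ℕ.+ v ℕ.∸ 1 →
    v ≡ b ℕ.* γ₁ ℕ.+ c ℕ.* δ₁ ⊎ v ≡ (b ℕ.+ c) ℕ.* γ₂ ℕ.+ c ℕ.* δ₂
  roots-of-x²+x-1 {p} b c {γ₁} {δ₁} {γ₂} {δ₂} {v} p-prime p≡ p∤c det₁ det₂ v₁<p v₂<p 0<v v<p p∣ =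
    Sum.map (λ p∣cv-k₁ → congruence-unique p-prime p∤c v<p v₁<p p∣cv-k₁ root₁)
            (λ p∣cv-k₂ → congruence-unique p-prime p∤c v<p v₂<p p∣cv-k₂ root₂)
            (prime∣*⇒∣⊎∣ p-prime (quadratic-factors B C P≡ (subst (+ p ∣_) (pos-x²+x-1 0<v) (∣ᵤ⇒∣ p∣))))
    where
    B = + b
    C = + c
    P≡ : + p ≡ B * B + + 3 * B * C + C * C
    P≡ = trans (cong +_ p≡) (pos-quadratic b c)
    pos-b+c : + (b ℕ.+ c) ≡ B + C
    pos-b+c = pos-+ b c
    pos-b+c+c : + (b ℕ.+ c ℕ.+ c) ≡ B + C + C
    pos-b+c+c = trans (pos-+ (b ℕ.+ c) c) (cong (_+ C) pos-b+c)
    pos-v₂ : + ((b ℕ.+ c) ℕ.* γ₂ ℕ.+ c ℕ.* δ₂) ≡ (B + C) * + γ₂ + C * + δ₂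
    pos-v₂ = trans (pos-lin (b ℕ.+ c) c γ₂ δ₂) (cong (λ X → X * + γ₂ + C * + δ₂) pos-b+c)
    det₁ℤ : (B + C + C) * + δ₁ ≡ (B + C) * + γ₁ + 1ℤ
    det₁ℤ = subst₂ (λ X Y → X * + δ₁ ≡ Y * + γ₁ + 1ℤ) pos-b+c+c pos-b+c (pos-det (b ℕ.+ c ℕ.+ c) (b ℕ.+ c) γ₁ δ₁ det₁)
    det₂ℤ : B * + γ₂ ≡ (B + C) * + δ₂ + 1ℤ
    det₂ℤ = subst (λ Y → B * + γ₂ ≡ Y * + δ₂ + 1ℤ) pos-b+c (pos-det b (b ℕ.+ c) δ₂ γ₂ det₂)
    root₁ : + p ∣ C * + (b ℕ.* γ₁ ℕ.+ c ℕ.* δ₁) - (B + C)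
    root₁ = subst (λ X → + p ∣ C * X - (B + C)) (sym (pos-lin b c γ₁ δ₁)) (root₊ B C P≡ det₁ℤ)
    root₂ : + p ∣ C * + ((b ℕ.+ c) ℕ.* γ₂ ℕ.+ c ℕ.* δ₂) - - (B + C + C)
    root₂ = subst (λ X → + p ∣ C * X - - (B + C + C)) (sym pos-v₂) (root₋ B C P≡ det₂ℤ)

open QuadraticCongruence using (roots-of-x²+x-1)

open import Data.Nat
open import Data.Nat.Properties
open import Data.Nat.DivMod
open import Data.Nat.Divisibility
open import Data.Nat.Coprimality as Coprime using (Coprime; coprime-+; prime⇒coprime)
open import Data.Nat.Induction using (<-wellFounded)
open import Data.Nat.Primality using (Prime)
open import Data.Nat.Tactic.RingSolver using (solve)
open import Data.Sign using (Sign; opposite)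
open import Induction.WellFounded using (Acc; acc)

Reaches : ℕ → ℕ → ℕ × ℕ → Set
Reaches u v t = ∃[ i ] euclidPair u v i ≡ t

euclidPair-+ : ∀ u v i k → euclidPair u v (k + i) ≡ euclidPair (prevRem u v i) (rem u v i) k
euclidPair-+ u v i zero    = refl
euclidPair-+ u v i (suc k) = cong euclidStep (euclidPair-+ u v i k)

Reaches-trans : ∀ {u v a b t} → Reaches u v (a , b) → Reaches a b t → Reaches u v t
Reaches-trans {u} {v} {a} {b} {t} (i , uv↝ab) (k , ab↝t) = k + i , (begin
  euclidPair u v (k + i)                    ≡⟨ euclidPair-+ u v i k ⟩
  euclidPair (prevRem u v i) (rem u v i) k  ≡⟨ cong (λ s → euclidPair (proj₁ s) (proj₂ s) k) uv↝ab ⟩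
  euclidPair a b k                          ≡⟨ ab↝t ⟩
  t                                         ∎)
  where open ≡-Reasoning

euclidStep-division : ∀ q {a b} → b < a → euclidStep (q * a + b , a) ≡ (a , b)
euclidStep-division q {suc a} {b} b<a = cong (suc a ,_) (begin
  (q * suc a + b) % suc a  ≡⟨ cong (_% suc a) (+-comm (q * suc a) b) ⟩
  (b + q * suc a) % suc a  ≡⟨ [m+kn]%n≡m%n b q (suc a) ⟩
  b % suc a                ≡⟨ m<n⇒m%n≡m b<a ⟩
  b                        ∎)
  where open ≡-Reasoning

proj₁-euclidStep : ∀ s → proj₁ (euclidStep s) ≡ proj₂ s
proj₁-euclidStep (a , zero)  = refl
proj₁-euclidStep (a , suc b) = refl

proj₂-euclidStep-≤ : ∀ s → proj₂ (euclidStep s) ≤ proj₂ s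
proj₂-euclidStep-≤ (a , zero)  = z≤n
proj₂-euclidStep-≤ (a , suc b) = <⇒≤ (m%n<n a (suc b))

rem-antitone : ∀ u v {i j} → j ≤ i → rem u v i ≤ rem u v j
rem-antitone u v {zero}  z≤n = ≤-refl
rem-antitone u v {suc i} j≤1+i with m≤n⇒m<n∨m≡n j≤1+i
... | inj₁ (s≤s j≤i) = ≤-trans (proj₂-euclidStep-≤ (euclidPair u v i)) (rem-antitone u v j≤i)
... | inj₂ refl      = ≤-refl

reached⇒≤-rem : ∀ {u v a b i} → euclidPair u v (suc i) ≡ (a , b) → ∀ {j} → j ≤ i → a ≤ rem u v j
reached⇒≤-rem {u} {v} {a} {b} {i} uv↝ab {j} j≤i = begin
  a                    ≡⟨ cong proj₁ uv↝ab ⟨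
  prevRem u v (suc i)  ≡⟨ proj₁-euclidStep (euclidPair u v i) ⟩
  rem u v i            ≤⟨ rem-antitone u v j≤i ⟩
  rem u v j            ∎
  where open ≤-Reasoning

Reaches-after-start : ∀ {u v a b} → Reaches u v (a , b) → a < u → ∃[ i ] euclidPair u v (suc i) ≡ (a , b)
Reaches-after-start (zero  , refl)  a<a = contradiction a<a (<-irrefl refl)
Reaches-after-start (suc i , uv↝ab) _   = i , uv↝ab

-- Read [[x , y] , [γ , δ]] as a matrix acting on the column (A , B).  Products of matrices
-- [[q , 1] , [1 , 0]] with q ≥ 1, i.e. continued fractions of x / y, have this property, and Det
-- records the sign of their determinant x δ - y γ.
Unwinds : ℕ → ℕ → ℕ → ℕ → Set
Unwinds x y γ δ = ∀ {A B} → 0 < B → B < A →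
  A * γ + B * δ < A * x + B * y × Reaches (A * x + B * y) (A * γ + B * δ) (A , B)

Det : Sign → ℕ → ℕ → ℕ → ℕ → Set
Det Sign.+ x y γ δ = x * δ ≡ y * γ + 1
Det Sign.- x y γ δ = y * γ ≡ x * δ + 1

unwinds-id : Unwinds 1 0 0 1
unwinds-id {A} {B} _ B<A
  rewrite *-zeroʳ A | *-identityʳ A | *-identityʳ B | *-zeroʳ B | +-identityʳ A = B<A , 0 , refl

unwinds-step : ∀ q {x y r γ δ} → 1 ≤ q → x ≡ q * y + r → Unwinds y r γ δ → Unwinds x y (q * γ + δ) γ
unwinds-step (suc q) {y = y} {r} {γ} {δ} _ refl unwinds {A} {B} 0<B B<A =
  subst₂ _<_ γ-eq x-eq lt ,
  Reaches-trans (subst₂ (λ u w → Reaches u w (suc q * A + B , A)) x-eq γ-eq reach)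
                (1 , euclidStep-division (suc q) B<A)
  where
  A<qA+B : A < suc q * A + B
  A<qA+B = ≤-trans (m<m+n A 0<B) (+-monoˡ-≤ B (m≤m+n A (q * A)))
  lt = proj₁ (unwinds (<-trans 0<B B<A) A<qA+B)
  reach = proj₂ (unwinds (<-trans 0<B B<A) A<qA+B)
  x-eq : (suc q * A + B) * y + A * r ≡ A * (suc q * y + r) + B * y
  x-eq = solve (q ∷ A ∷ B ∷ y ∷ r ∷ [])
  γ-eq : (suc q * A + B) * γ + A * δ ≡ A * (suc q * γ + δ) + B * γ
  γ-eq = solve (q ∷ A ∷ B ∷ γ ∷ δ ∷ [])

det-step : ∀ s q {x y r γ δ} → x ≡ q * y + r → Det (opposite s) y r γ δ → Det s x y (q * γ + δ) γ
det-step Sign.+ q {y = y} {r} {γ} {δ} refl det = begin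
  (q * y + r) * γ          ≡⟨ solve (q ∷ y ∷ r ∷ γ ∷ []) ⟩
  q * y * γ + r * γ        ≡⟨ cong (q * y * γ +_) det ⟩
  q * y * γ + (y * δ + 1)  ≡⟨ solve (q ∷ y ∷ γ ∷ δ ∷ []) ⟩
  y * (q * γ + δ) + 1      ∎
  where open ≡-Reasoning
det-step Sign.- q {y = y} {r} {γ} {δ} refl det = begin
  y * (q * γ + δ)          ≡⟨ solve (q ∷ y ∷ γ ∷ δ ∷ []) ⟩
  q * y * γ + y * δ        ≡⟨ cong (q * y * γ +_) det ⟩
  q * y * γ + (r * γ + 1)  ≡⟨ solve (q ∷ y ∷ r ∷ γ ∷ []) ⟩
  (q * y + r) * γ + 1      ∎
  where open ≡-Reasoning

coprime-rem : ∀ q {x y r} → x ≡ q * y + r → Coprime x y → Coprime y r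
coprime-rem q refl x⊥y (d∣y , d∣r) = x⊥y (∣m∣n⇒∣m+n (∣n⇒∣m*n q d∣y) d∣r , d∣y)

unwinding : ∀ s {x y} → Coprime x y → 0 < y → y < x → ∃₂ λ γ δ → Det s x y γ δ × Unwinds x y γ δ
unwinding s x⊥y 0<y y<x = go s x⊥y 0<y y<x (<-wellFounded _)
  where
  go : ∀ s {x y} → Coprime x y → 0 < y → y < x → Acc _<_ y → ∃₂ λ γ δ → Det s x y γ δ × Unwinds x y γ δ
  go Sign.- {x} {1} _ _ 1<x _ =
    _ , _ , *-identityˡ (x * 0 + 1) , unwinds-step x (<⇒≤ 1<x) x≡x*1+0 unwinds-id
    where
    x≡x*1+0 : x ≡ x * 1 + 0
    x≡x*1+0 = solve (x ∷ [])
  go Sign.+ {1} {1} _ _ (s≤s ()) _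
  -- the expansion x / 1 = (x - 1) + 1 / 1 has one more step, hence the other sign
  go Sign.+ {suc (suc k)} {1} _ _ _ _ =
    _ , _ , det , unwinds-step (suc k) (s≤s z≤n) x≡ (unwinds-step 1 ≤-refl refl unwinds-id)
    where
    x≡ : suc (suc k) ≡ suc k * 1 + 1
    x≡ = solve (k ∷ [])
    det : suc (suc k) * 1 ≡ 1 * (suc k * 1 + 0) + 1
    det = solve (k ∷ [])
  go s {x} {y@(suc (suc _))} x⊥y _ y<x (acc rec) with x % y in x%y≡r | m%n<n x y
  ... | zero  | _   = contradiction (x⊥y (m%n≡0⇒n∣m x y x%y≡r , ∣-refl)) λ ()
  ... | suc r | r<y =
    let (γ , δ , det , unwinds) = go (opposite s) (coprime-rem q x≡ x⊥y) (s≤s z≤n) r<y (rec r<y)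
    in  _ , _ , det-step s q x≡ det , unwinds-step q (m≥n⇒m/n>0 (<⇒≤ y<x)) x≡ unwinds
    where
    q = x / y
    x≡ : x ≡ q * y + suc r
    x≡ = trans (m≡m%n+[m/n]*n x y) (trans (cong (_+ q * y) x%y≡r) (+-comm (suc r) (q * y)))

five-c²<p : ∀ {b c} → c < b → 5 * (c * c) < b * b + 3 * b * c + c * c
five-c²<p {b} {c} c<b = begin-strict
  5 * (c * c)                ≡⟨ solve (c ∷ []) ⟩
  c * c + 3 * c * c + c * c  <⟨ +-monoˡ-< (c * c) (+-mono-<-≤ (*-mono-< c<b c<b) (*-monoˡ-≤ c (*-monoʳ-≤ 3 (<⇒≤ c<b)))) ⟩
  b * b + 3 * b * c + c * c  ∎
  where open ≤-Reasoning

p≤five-b² : ∀ {b c} → c ≤ b → b * b + 3 * b * c + c * c ≤ 5 * (b * b)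
p≤five-b² {b} {c} c≤b = begin
  b * b + 3 * b * c + c * c  ≤⟨ +-mono-≤ (+-monoʳ-≤ (b * b) (*-monoʳ-≤ (3 * b) c≤b)) (*-mono-≤ c≤b c≤b) ⟩
  b * b + 3 * b * b + b * b  ≡⟨ solve (b ∷ []) ⟩
  5 * (b * b)                ∎
  where open ≤-Reasoning

b+c<p : ∀ {b c} → 0 < c → c < b → b + c < b * b + 3 * b * c + c * c
b+c<p {suc b} {suc c} _ _ = begin-strict
  suc b + suc c                                      ≤⟨ +-mono-≤ (m≤m*n (suc b) (suc b)) (m≤m*n (suc c) (suc c)) ⟩
  suc b * suc b + suc c * suc c                      <⟨ +-monoˡ-< (suc c * suc c) (m<m+n (suc b * suc b) (s≤s z≤n)) ⟩
  suc b * suc b + 3 * suc b * suc c + suc c * suc c  ∎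
  where open ≤-Reasoning

prime-form⇒coprime : ∀ {b c} → Prime (b * b + 3 * b * c + c * c) → 0 < c → c < b * b + 3 * b * c + c * c → Coprime b c
prime-form⇒coprime {b} {c} p-prime 0<c c<p (d∣b , d∣c) =
  prime⇒coprime p-prime ⦃ >-nonZero 0<c ⦄ c<p (d∣p , d∣c)
  where
  d∣p = ∣m∣n⇒∣m+n (∣m∣n⇒∣m+n (∣m⇒∣m*n b d∣b) (∣n⇒∣m*n (3 * b) d∣c)) (∣m⇒∣m*n c d∣c)

reaches-b-c : ∀ {b c} → Coprime b c → 0 < c → c < b →
  ∃₂ λ γ δ → Det Sign.+ (b + c + c) (b + c) γ δ
    × b * γ + c * δ < b * b + 3 * b * c + c * c
    × Reaches (b * b + 3 * b * c + c * c) (b * γ + c * δ) (b , c)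
reaches-b-c {b} {c} b⊥c 0<c c<b =
  let (γ , δ , det , unwinds) = unwinding Sign.+ (coprime-+ (Coprime.sym b+c⊥c)) 0<b+c (m<m+n (b + c) 0<c)
  in  γ , δ , det , subst (λ u → b * γ + c * δ < u × Reaches u (b * γ + c * δ) (b , c)) expand (unwinds 0<c c<b)
  where
  b+c⊥c : Coprime (b + c) c
  b+c⊥c = subst (λ x → Coprime x c) (+-comm c b) (coprime-+ b⊥c)
  0<b+c : 0 < b + c
  0<b+c = <-≤-trans 0<c (m≤n+m c b)
  expand : b * (b + c + c) + c * (b + c) ≡ b * b + 3 * b * c + c * c
  expand = solve (b ∷ c ∷ [])

reaches-b+c-c : ∀ {b c} → Coprime b c → 0 < c → c < b →
  ∃₂ λ γ δ → Det Sign.- (b + c) b γ δ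
    × (b + c) * γ + c * δ < b * b + 3 * b * c + c * c
    × Reaches (b * b + 3 * b * c + c * c) ((b + c) * γ + c * δ) (b + c , c)
reaches-b+c-c {b} {c} b⊥c 0<c c<b =
  let (γ , δ , det , unwinds) = unwinding Sign.- (coprime-+ (Coprime.sym b⊥c)) 0<b (m<m+n b 0<c)
  in  γ , δ , det ,
      subst (λ u → (b + c) * γ + c * δ < u × Reaches u ((b + c) * γ + c * δ) (b + c , c)) expand
            (unwinds 0<c (m<n+m c 0<b))
  where
  0<b : 0 < b
  0<b = <-trans 0<c c<b
  expand : (b + c) * (b + c) + c * b ≡ b * b + 3 * b * c + c * c
  expand = solve (b ∷ c ∷ [])

FirstSmallRemainder : ℕ → ℕ → ℕ → ℕ → Set
FirstSmallRemainder p v b c = ∃[ i ] (1 ≤ i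
  × 5 * (rem p v i * rem p v i) < p
  × (∀ j → 1 ≤ j → j < i → p ≤ 5 * (rem p v j * rem p v j))
  × rem p v i ≡ c
  × (prevRem p v i ≡ b ⊎ prevRem p v i ≡ b + c))

first-small-remainder : ∀ {v b c a} → 0 < c → c < b → a ≡ b ⊎ a ≡ b + c →
  Reaches (b * b + 3 * b * c + c * c) v (a , c) → FirstSmallRemainder (b * b + 3 * b * c + c * c) v b c
first-small-remainder {v} {b} {c} {a} 0<c c<b a≡ reach
  with Reaches-after-start reach (≤-<-trans a≤b+c (b+c<p 0<c c<b))
  where
  a≤b+c : a ≤ b + c
  a≤b+c = [ (λ { refl → m≤m+n b c }) , (λ { refl → ≤-refl }) ]′ a≡
... | i , pv↝ac = suc i , s≤s z≤n , small , large , cong proj₂ pv↝ac ,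
                  subst (λ x → x ≡ b ⊎ x ≡ b + c) (cong proj₁ (sym pv↝ac)) a≡
  where
  p = b * b + 3 * b * c + c * c
  small : 5 * (rem p v (suc i) * rem p v (suc i)) < p
  small rewrite cong proj₂ pv↝ac = five-c²<p c<b
  b≤a : b ≤ a
  b≤a = [ (λ { refl → ≤-refl }) , (λ { refl → m≤m+n b c }) ]′ a≡
  large : ∀ j → 1 ≤ j → j < suc i → p ≤ 5 * (rem p v j * rem p v j)
  large j _ (s≤s j≤i) = ≤-trans (p≤five-b² (<⇒≤ c<b)) (*-monoʳ-≤ 5 (*-mono-≤ b≤r b≤r))
    where
    b≤r = ≤-trans b≤a (reached⇒≤-rem pv↝ac j≤i)

mainTheorem1 : (p : ℕ) → Prime p → (p % 5 ≡ 1 ⊎ p % 5 ≡ 4) →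
    (b c : ℕ) → 0 < c → c < b → p ≡ b * b + 3 * b * c + c * c →
    (v : ℕ) → 0 < v → v < p → p ∣ (v * v + v ∸ 1) →
    ∃[ i ] (1 ≤ i
    × 5 * (rem p v i * rem p v i) < p
    × (∀ j → 1 ≤ j → j < i → p ≤ 5 * (rem p v j * rem p v j))
    × rem p v i ≡ c
    × (prevRem p v i ≡ b ⊎ prevRem p v i ≡ b + c))
-- The congruence p ≡ ±1 (mod 5) only guarantees that b and c exist.
mainTheorem1 _ p-prime _ b c 0<c c<b refl v 0<v v<p p∣v²+v-1 =
  let (γ₁ , δ₁ , det₁ , v₁<p , reach₁) = reaches-b-c b⊥c 0<c c<b
      (γ₂ , δ₂ , det₂ , v₂<p , reach₂) = reaches-b+c-c b⊥c 0<c c<b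
  in [ (λ { refl → first-small-remainder 0<c c<b (inj₁ refl) reach₁ })
     , (λ { refl → first-small-remainder 0<c c<b (inj₂ refl) reach₂ })
     ]′ (roots-of-x²+x-1 b c p-prime refl p∤c det₁ det₂ v₁<p v₂<p 0<v v<p p∣v²+v-1)
  where
  c<p : c < b * b + 3 * b * c + c * c
  c<p = <-trans (m<n+m c (<-trans 0<c c<b)) (b+c<p 0<c c<b)
  b⊥c : Coprime b c
  b⊥c = prime-form⇒coprime p-prime 0<c c<p
  p∤c : ¬ b * b + 3 * b * c + c * c ∣ c
  p∤c = >⇒∤ ⦃ >-nonZero 0<c ⦄ c<p
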